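{- Let $k\ge 1$ and let $G$ be a $k$-edge-connected graph with exactly $q$ $k$-cuts. Let $A_1,\dots,A_t$ be all the distinct $k$-critical-sets of $G$. Then: (i) $A_i\cap A_j=\emptyset$ for all $i\neq j$; (ii) if $q=1$, then $t=2$ and $A_2=V(G)\setminus A_1$; (iii) if $q\ge 2$, then $\partial(A_i)\neq\partial(A_j)$ for all $i\ne j$, and hence $t\le q$; (iv) if $G'$ is obtained from $G$ by adding a new vertex $x$ and, for each $i=1,\dots,t$, one new edge joining $x$ to some vertex of $A_i$, then every edge cut of $G'$ other than $\partial_{G'}(x)$ has size at least $k+1$.
   Context: Graphs are finite, without loops, parallel edges allowed. For $\emptyset\ne A\subsetneq V(G)$, $\partial_G(A)$ is the set of edges with exactly one end in $A$ and $d_G(A)=|\partial_G(A)|$. A $k$-cut is an edge cut $\partial_G(A)$ with exactly $k$ edges; $q$ counts distinct such edge sets (including those isolating a single vertex). A nonempty proper subset $A\subsetneq V(G)$ is a $k$-critical-set (and $\partial(A)$ a $k$-critical-cut) if $d(A)\le k$ and $d(B)>k$ for every nonempty $B\subsetneq A$. -}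

module Defs where

open import Data.Nat using (ℕ; _≤_; _<_; _+_; suc)
open import Data.Fin using (Fin; fromℕ; inject₁; splitAt)
open import Data.Fin.Properties using (fromℕ≢inject₁; inject₁-injective)
open import Data.Fin.Subset using (Subset; _∈_; _⊆_; ⊤; ∣_∣; Nonempty; ⁅_⁆)
open import Data.Vec using (lookup; tabulate)
open import Data.Bool using (_xor_)
open import Data.Product using (_×_; _,_; proj₁; proj₂; ∃)
open import Data.Sum using (inj₁; inj₂)
open import Relation.Binary.PropositionalEquality using (_≡_; _≢_)
open import Function using (_∘_)

-- A finite loopless multigraph: vertices Fin n, edges Fin m (parallel edges allowed).
record Graph : Set where
  field
    n     : ℕ
    m     : ℕ
    ends  : Fin m → Fin n × Fin n
    loopless : ∀ e → proj₁ (ends e) ≢ proj₂ (ends e)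
open Graph public

V : Graph → Set
V G = Fin (n G)

Proper : (G : Graph) → Subset (n G) → Set
Proper G A = Nonempty A × A ≢ ⊤

∂ : (G : Graph) → Subset (n G) → Subset (m G)
∂ G A = tabulate λ e → lookup A (proj₁ (ends G e)) xor lookup A (proj₂ (ends G e))

d : (G : Graph) → Subset (n G) → ℕ
d G A = ∣ ∂ G A ∣

IsEdgeCut : (G : Graph) → Subset (m G) → Set
IsEdgeCut G S = ∃ λ A → Proper G A × ∂ G A ≡ S

IsKCut : (G : Graph) → ℕ → Subset (m G) → Set
IsKCut G k S = IsEdgeCut G S × ∣ S ∣ ≡ k

-- G has exactly q k-cuts: an injective enumeration of all k-cuts (as edge sets) by Fin q
HasExactlyKCuts : (G : Graph) → ℕ → ℕ → Set
HasExactlyKCuts G k q = ∃ λ (c : Fin q → Subset (m G)) →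
  (∀ i j → c i ≡ c j → i ≡ j) × (∀ i → IsKCut G k (c i)) × (∀ S → IsKCut G k S → ∃ λ i → c i ≡ S)

KEdgeConnected : Graph → ℕ → Set
KEdgeConnected G k = ∀ A → Proper G A → k ≤ d G A

IsKCritical : (G : Graph) → ℕ → Subset (n G) → Set
IsKCritical G k A = Proper G A × d G A ≤ k ×
  (∀ B → Nonempty B → B ⊆ A → B ≢ A → k < d G B)

AllKCritical : (G : Graph) → ℕ → (t : ℕ) → (Fin t → Subset (n G)) → Set
AllKCritical G k t a = (∀ i j → a i ≡ a j → i ≡ j) × (∀ i → IsKCritical G k (a i)) ×
  (∀ A → IsKCritical G k A → ∃ λ i → a i ≡ A)

extend : (G : Graph) (t : ℕ) → (Fin t → V G) → Graph
extend G t v = record { n = suc (n G) ; m = m G + t ; ends = ends' ; loopless = ll }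
  where
  ends'' : Fin (m G) → Fin (suc (n G)) × Fin (suc (n G))
  ends'' e = inject₁ (proj₁ (ends G e)) , inject₁ (proj₂ (ends G e))
  ends' : Fin (m G + t) → Fin (suc (n G)) × Fin (suc (n G))
  ends' e with splitAt (m G) e
  ... | inj₁ e' = ends'' e'
  ... | inj₂ i = fromℕ (n G) , inject₁ (v i)
  ll : ∀ e → proj₁ (ends' e) ≢ proj₂ (ends' e)
  ll e with splitAt (m G) e
  ... | inj₁ e' = λ eq → loopless G e' (inject₁-injective eq)
  ... | inj₂ i = fromℕ≢inject₁

newVertex : (G : Graph) (t : ℕ) (v : Fin t → V G) → V (extend G t v)
newVertex G t v = fromℕ (n G)

-- Cut size is posimodular, d(A ─ B) + d(B ─ A) ≤ d(A) + d(B), so two distinct k-critical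
-- sets that meet would give 2k < d(A ─ B) + d(B ─ A) ≤ 2k; hence they are disjoint. Every
-- k-cut ∂X has a critical set on each side, and in a connected graph ∂ determines its side up
-- to complement. If two critical sets have the same cut they are complementary, and then the
-- critical sets on the two sides of any k-cut force that cut to be theirs, so q = 1; when q = 1
-- the same argument shows that both sides of the unique k-cut are critical and nothing else is.
-- In G′, after complementing so that x ∉ A, the cut of A is the cut of its trace X in G plus
-- one new edge for each Aᵢ meeting X; either d(X) > k, or X contains a critical set, i.e. an Aᵢ.

module Submission where

open import Defs
open import Data.Nat.Properties
open import Algebra.Properties.CommutativeMonoid.Sum +-0-commutativeMonoid
  using (sum; sum-syntax; ∑-distrib-+; sum-cong-≗)
import Algebra.Properties.CommutativeSemigroup as CommutativeSemigroupProperties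
import Algebra.Lattice.Properties.BooleanAlgebra as BooleanAlgebraProperties
open import Algebra.Bundles using (CommutativeRing)
open import Data.Bool using (Bool; true; false; not; _∧_; _xor_)
open import Data.Bool.Properties
  using (xor-∧-commutativeRing; xor-same; xor-assoc; xor-identityʳ; not-distribˡ-xor; not-distribʳ-xor;
         not-involutive; ∧-zeroʳ; ∧-identityʳ)
  renaming (_≟_ to _≟ᵇ_)
open import Data.Nat using (ℕ; zero; suc; _+_; _≤_; _<_; z≤n; s≤s; _≤?_)
open import Data.Fin using (Fin; zero; suc; _↑ˡ_; _↑ʳ_; fromℕ; inject₁)
open import Data.Fin.Properties
  using (¬∀⟶∃¬; injective⇒≤; splitAt-↑ˡ; splitAt-↑ʳ)
  renaming (_≟_ to _≟ᶠ_)
open import Data.Fin.Subset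
open import Data.Fin.Subset.Properties
open import Data.Fin.Subset.Induction using (⊂-wellFounded)
open import Data.Vec using ([]; _∷_; tabulate; lookup; zipWith)
open import Data.Vec.Properties
  using (lookup-zipWith; lookup-map; lookup∘tabulate; tabulate∘lookup; tabulate-cong; ≡-dec;
         []=⇒lookup; lookup⇒[]=)
open import Data.Product using (_×_; _,_; proj₁; proj₂; ∃)
open import Data.Sum using (_⊎_; inj₁; inj₂; [_,_]′)
open import Function using (_∘_)
open import Induction.WellFounded using (Acc; acc)
open import Relation.Nullary using (¬_; yes; no; contradiction)
open import Relation.Nullary.Decidable using (_×-dec_; _→-dec_; decidable-stable)
open import Relation.Binary.PropositionalEquality

⟦_⟧ : Bool → ℕ
⟦ true ⟧ = 1
⟦ false ⟧ = 0

∑-mono-≤ : ∀ {m} {f g : Fin m → ℕ} → (∀ i → f i ≤ g i) → sum f ≤ sum g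
∑-mono-≤ {zero} _ = z≤n
∑-mono-≤ {suc m} f≤g = +-mono-≤ (f≤g zero) (∑-mono-≤ (f≤g ∘ suc))

∑-↑ : ∀ m {t} (f : Fin (m + t) → ℕ) → sum f ≡ sum (f ∘ (_↑ˡ t)) + sum (f ∘ (m ↑ʳ_))
∑-↑ zero f = refl
∑-↑ (suc m) f = trans (cong (f zero +_) (∑-↑ m (f ∘ suc))) (sym (+-assoc (f zero) _ _))

term≤∑ : ∀ {m} (f : Fin m → ℕ) i → f i ≤ sum f
term≤∑ f zero = m≤m+n (f zero) _
term≤∑ f (suc i) = ≤-trans (term≤∑ (f ∘ suc) i) (m≤n+m _ (f zero))

1≤∑⟦⟧ : ∀ {m} (f : Fin m → Bool) {i} → f i ≡ true → 1 ≤ ∑[ j < m ] ⟦ f j ⟧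
1≤∑⟦⟧ {m} f {i} fi≡true = subst (λ b → ⟦ b ⟧ ≤ ∑[ j < m ] ⟦ f j ⟧) fi≡true (term≤∑ (λ j → ⟦ f j ⟧) i)

∣tabulate∣≡∑ : ∀ {m} (f : Fin m → Bool) → ∣ tabulate f ∣ ≡ ∑[ i < m ] ⟦ f i ⟧
∣tabulate∣≡∑ {zero} f = refl
∣tabulate∣≡∑ {suc m} f with f zero
... | true = cong suc (∣tabulate∣≡∑ (f ∘ suc))
... | false = ∣tabulate∣≡∑ (f ∘ suc)

xor-interchange : ∀ a b c d → (a xor b) xor (c xor d) ≡ (a xor c) xor (b xor d)
xor-interchange = CommutativeSemigroupProperties.interchange
  (CommutativeRing.+-commutativeSemigroup xor-∧-commutativeRing)

-- aᵢ and bᵢ record whether the i-th end of an edge lies in A and in B.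
crossing-posimodular : ∀ a₁ a₂ b₁ b₂ →
  ⟦ (a₁ ∧ not b₁) xor (a₂ ∧ not b₂) ⟧ + ⟦ (b₁ ∧ not a₁) xor (b₂ ∧ not a₂) ⟧ ≤ ⟦ a₁ xor a₂ ⟧ + ⟦ b₁ xor b₂ ⟧
crossing-posimodular true  true  true  true  = z≤n
crossing-posimodular true  true  true  false = s≤s z≤n
crossing-posimodular true  true  false true  = s≤s z≤n
crossing-posimodular true  true  false false = z≤n
crossing-posimodular true  false true  true  = s≤s z≤n
crossing-posimodular true  false true  false = z≤n
crossing-posimodular true  false false true  = s≤s (s≤s z≤n)
crossing-posimodular true  false false false = s≤s z≤n
crossing-posimodular false true  true  true  = s≤s z≤n
crossing-posimodular false true  true  false = s≤s (s≤s z≤n)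
crossing-posimodular false true  false true  = z≤n
crossing-posimodular false true  false false = s≤s z≤n
crossing-posimodular false false true  true  = z≤n
crossing-posimodular false false true  false = s≤s z≤n
crossing-posimodular false false false true  = s≤s z≤n
crossing-posimodular false false false false = z≤n

infixl 6 _⊕_

_⊕_ : ∀ {n} → Subset n → Subset n → Subset n
_⊕_ = zipWith _xor_

p⊕p≡⊥ : ∀ {n} (p : Subset n) → p ⊕ p ≡ ⊥
p⊕p≡⊥ [] = refl
p⊕p≡⊥ (x ∷ p) = cong₂ _∷_ (xor-same x) (p⊕p≡⊥ p)

⊥⊕p≡p : ∀ {n} (p : Subset n) → ⊥ ⊕ p ≡ p
⊥⊕p≡p [] = refl
⊥⊕p≡p (x ∷ p) = cong (x ∷_) (⊥⊕p≡p p)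

⊤⊕p≡∁p : ∀ {n} (p : Subset n) → ⊤ ⊕ p ≡ ∁ p
⊤⊕p≡∁p [] = refl
⊤⊕p≡∁p (x ∷ p) = cong (not x ∷_) (⊤⊕p≡∁p p)

p⊕q⊕q≡p : ∀ {n} (p q : Subset n) → p ⊕ q ⊕ q ≡ p
p⊕q⊕q≡p [] [] = refl
p⊕q⊕q≡p (x ∷ p) (y ∷ q) = cong₂ _∷_ x⊕y⊕y≡x (p⊕q⊕q≡p p q)
  where
  x⊕y⊕y≡x : (x xor y) xor y ≡ x
  x⊕y⊕y≡x = trans (xor-assoc x y y) (trans (cong (x xor_) (xor-same y)) (xor-identityʳ x))

lookup-─ : ∀ {n} (p q : Subset n) i → lookup (p ─ q) i ≡ lookup p i ∧ not (lookup q i)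
lookup-─ (x ∷ p) (true ∷ q) zero = sym (∧-zeroʳ x)
lookup-─ (x ∷ p) (false ∷ q) zero = sym (∧-identityʳ x)
lookup-─ (_ ∷ p) (_ ∷ q) (suc i) = lookup-─ p q i

∉⇒lookup≡false : ∀ {n} {x : Fin n} {p} → x ∉ p → lookup p x ≡ false
∉⇒lookup≡false {x = x} {p} x∉p with lookup p x in eq
... | true = contradiction (lookup⇒[]= x p eq) x∉p
... | false = refl

∁-involutive : ∀ {n} (p : Subset n) → ∁ (∁ p) ≡ p
∁-involutive {n} = BooleanAlgebraProperties.¬-involutive (∪-∩-booleanAlgebra n)

p≢∁p : ∀ {n} {p : Subset n} → Nonempty p → p ≢ ∁ p
p≢∁p (x , x∈p) p≡∁p = x∈p⇒x∉∁p x∈p (subst (x ∈_) p≡∁p x∈p)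

≢⊤⇒∃∉ : ∀ {n} {p : Subset n} → p ≢ ⊤ → ∃ λ x → x ∉ p
≢⊤⇒∃∉ {n} {p} p≢⊤ = ¬∀⟶∃¬ n (_∈ p) (_∈? p) (λ ∀∈ → p≢⊤ (⊆-antisym ⊆⊤ (λ {x} _ → ∀∈ x)))

⊆∧≢⇒⊂ : ∀ {n} {p q : Subset n} → p ⊆ q → p ≢ q → p ⊂ q
⊆∧≢⇒⊂ {n} {p} {q} p⊆q p≢q
  with ¬∀⟶∃¬ n (λ x → x ∈ q → x ∈ p) (λ x → x ∈? q →-dec x ∈? p) (λ q⊆p → p≢q (⊆-antisym p⊆q (λ {x} → q⊆p x)))
... | x , q⇏p = p⊆q , x , decidable-stable (x ∈? q) (λ x∉q → q⇏p (λ x∈q → contradiction x∈q x∉q))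
                          , (λ x∈p → q⇏p (λ _ → x∈p))

¬nonempty∧≢⊤⇒⊥⊎⊤ : ∀ {n} {p : Subset n} → ¬ (Nonempty p × p ≢ ⊤) → p ≡ ⊥ ⊎ p ≡ ⊤
¬nonempty∧≢⊤⇒⊥⊎⊤ {p = p} ¬proper with nonempty? p | ≡-dec _≟ᵇ_ p ⊤
... | no empty | _ = inj₁ (Empty-unique empty)
... | yes _ | yes p≡⊤ = inj₂ p≡⊤
... | yes ne | no p≢⊤ = contradiction (ne , p≢⊤) ¬proper

other-of-complementary-pair : ∀ {n} {A C D : Subset n} → C ≡ A ⊎ C ≡ ∁ A → D ≡ A ⊎ D ≡ ∁ A → C ≢ D → D ≡ ∁ C
other-of-complementary-pair (inj₁ refl) (inj₁ refl) C≢D = contradiction refl C≢D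
other-of-complementary-pair (inj₁ refl) (inj₂ refl) _ = refl
other-of-complementary-pair (inj₂ refl) (inj₁ refl) _ = sym (∁-involutive _)
other-of-complementary-pair (inj₂ refl) (inj₂ refl) C≢D = contradiction refl C≢D

lookup-ext : ∀ {n} {p q : Subset n} → (∀ i → lookup p i ≡ lookup q i) → p ≡ q
lookup-ext {p = p} {q} p≗q = trans (sym (tabulate∘lookup p)) (trans (tabulate-cong p≗q) (tabulate∘lookup q))

fromℕ-or-inject₁ : ∀ {n} (y : Fin (suc n)) → y ≡ fromℕ n ⊎ ∃ λ u → y ≡ inject₁ u
fromℕ-or-inject₁ {zero} zero = inj₁ refl
fromℕ-or-inject₁ {suc n} zero = inj₂ (zero , refl)
fromℕ-or-inject₁ {suc n} (suc y) with fromℕ-or-inject₁ y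
... | inj₁ y≡last = inj₁ (cong suc y≡last)
... | inj₂ (u , y≡u) = inj₂ (suc u , cong suc y≡u)

restrict : ∀ {n} → Subset (suc n) → Subset n
restrict A = tabulate (lookup A ∘ inject₁)

module _ {n} {A : Subset (suc n)} where

  lookup-restrict : ∀ u → lookup (restrict A) u ≡ lookup A (inject₁ u)
  lookup-restrict = lookup∘tabulate (lookup A ∘ inject₁)

  ∈-restrict⁺ : ∀ {u} → inject₁ u ∈ A → u ∈ restrict A
  ∈-restrict⁺ {u} u∈A = lookup⇒[]= u (restrict A) (trans (lookup-restrict u) ([]=⇒lookup u∈A))

  ∈-restrict⁻ : ∀ {u} → u ∈ restrict A → inject₁ u ∈ A
  ∈-restrict⁻ {u} u∈A↾ = lookup⇒[]= (inject₁ u) A (trans (sym (lookup-restrict u)) ([]=⇒lookup u∈A↾))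

  restrict-Empty : fromℕ n ∉ A → Empty (restrict A) → Empty A
  restrict-Empty last∉A empty (y , y∈A) with fromℕ-or-inject₁ y
  ... | inj₁ refl = last∉A y∈A
  ... | inj₂ (u , refl) = empty (u , ∈-restrict⁺ y∈A)

  restrict≡⊤ : fromℕ n ∉ A → restrict A ≡ ⊤ → A ≡ ∁ ⁅ fromℕ n ⁆
  restrict≡⊤ last∉A A↾≡⊤ = ⊆-antisym A⊆ A⊇
    where
    A⊆ : A ⊆ ∁ ⁅ fromℕ n ⁆
    A⊆ {y} y∈A = x∉p⇒x∈∁p λ y∈⁅last⁆ → last∉A (subst (_∈ A) (x∈⁅y⁆⇒x≡y _ y∈⁅last⁆) y∈A)
    A⊇ : ∁ ⁅ fromℕ n ⁆ ⊆ A
    A⊇ {y} y∉⁅last⁆ with fromℕ-or-inject₁ y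
    ... | inj₁ refl = contradiction (x∈⁅x⁆ _) (x∈∁p⇒x∉p y∉⁅last⁆)
    ... | inj₂ (u , refl) = ∈-restrict⁻ (subst (u ∈_) (sym A↾≡⊤) ∈⊤)

≢⇒2≤ : ∀ {t} {i j : Fin t} → i ≢ j → 2 ≤ t
≢⇒2≤ {suc zero} {zero} {zero} i≢j = contradiction refl i≢j
≢⇒2≤ {suc (suc t)} _ = s≤s (s≤s z≤n)

module _ {ℓ} {X : Set ℓ} {x y : X} where

  private
    side : ∀ {z} → z ≡ x ⊎ z ≡ y → Fin 2
    side (inj₁ _) = zero
    side (inj₂ _) = suc zero

    side-injective : ∀ {z w} (p : z ≡ x ⊎ z ≡ y) (q : w ≡ x ⊎ w ≡ y) → side p ≡ side q → z ≡ w
    side-injective (inj₁ z≡x) (inj₁ w≡x) _ = trans z≡x (sym w≡x)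
    side-injective (inj₂ z≡y) (inj₂ w≡y) _ = trans z≡y (sym w≡y)
    side-injective (inj₁ _) (inj₂ _) ()
    side-injective (inj₂ _) (inj₁ _) ()

  injective-enumeration-of-pair : ∀ {t} {a : Fin t → X} → (∀ i j → a i ≡ a j → i ≡ j) →
    (∀ i → a i ≡ x ⊎ a i ≡ y) → (∃ λ i → a i ≡ x) → (∃ λ j → a j ≡ y) → x ≢ y → t ≡ 2
  injective-enumeration-of-pair {a = a} a-inj a-pair (i , ai≡x) (j , aj≡y) x≢y = ≤-antisym
    (injective⇒≤ {f = side ∘ a-pair} λ eq → a-inj _ _ (side-injective (a-pair _) (a-pair _) eq))
    (≢⇒2≤ {i = i} {j} λ i≡j → x≢y (trans (sym ai≡x) (trans (cong a i≡j) aj≡y)))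

-- Edge cuts

separates : ∀ {n} → Subset n → Fin n × Fin n → Bool
separates A uw = lookup A (proj₁ uw) xor lookup A (proj₂ uw)

separates-⊕ : ∀ {n} (A B : Subset n) uw → separates (A ⊕ B) uw ≡ separates A uw xor separates B uw
separates-⊕ A B (u , w) = trans (cong₂ _xor_ (lookup-zipWith _xor_ u A B) (lookup-zipWith _xor_ w A B))
                                (xor-interchange (lookup A u) (lookup B u) (lookup A w) (lookup B w))

separates-∁ : ∀ {n} (A : Subset n) uw → separates (∁ A) uw ≡ separates A uw
separates-∁ A (u , w) = begin
  lookup (∁ A) u xor lookup (∁ A) w     ≡⟨ cong₂ _xor_ (lookup-map u not A) (lookup-map w not A) ⟩
  not (lookup A u) xor not (lookup A w) ≡⟨ sym (not-distribˡ-xor (lookup A u) _) ⟩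
  not (lookup A u xor not (lookup A w)) ≡⟨ cong not (sym (not-distribʳ-xor (lookup A u) _)) ⟩
  not (not (lookup A u xor lookup A w)) ≡⟨ not-involutive _ ⟩
  lookup A u xor lookup A w             ∎
  where open ≡-Reasoning

separates-─ : ∀ {n} (A B : Subset n) uw → separates (A ─ B) uw ≡
  (lookup A (proj₁ uw) ∧ not (lookup B (proj₁ uw))) xor (lookup A (proj₂ uw) ∧ not (lookup B (proj₂ uw)))
separates-─ A B (u , w) = cong₂ _xor_ (lookup-─ A B u) (lookup-─ A B w)

module _ (G : Graph) where

  cut-indicator : Subset (n G) → Fin (m G) → ℕ
  cut-indicator A e = ⟦ separates A (ends G e) ⟧

  d≡∑ : ∀ A → d G A ≡ sum (cut-indicator A)
  d≡∑ A = ∣tabulate∣≡∑ (separates A ∘ ends G)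

  ∂-⊕ : ∀ A B → ∂ G (A ⊕ B) ≡ ∂ G A ⊕ ∂ G B
  ∂-⊕ A B = lookup-ext λ e → begin
    lookup (∂ G (A ⊕ B)) e
      ≡⟨ lookup∘tabulate _ e ⟩
    separates (A ⊕ B) (ends G e)
      ≡⟨ separates-⊕ A B (ends G e) ⟩
    separates A (ends G e) xor separates B (ends G e)
      ≡⟨ sym (cong₂ _xor_ (lookup∘tabulate _ e) (lookup∘tabulate _ e)) ⟩
    lookup (∂ G A) e xor lookup (∂ G B) e
      ≡⟨ sym (lookup-zipWith _xor_ e (∂ G A) (∂ G B)) ⟩
    lookup (∂ G A ⊕ ∂ G B) e ∎
    where open ≡-Reasoning

  ∂-∁ : ∀ A → ∂ G (∁ A) ≡ ∂ G A
  ∂-∁ A = tabulate-cong (separates-∁ A ∘ ends G)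

  d-∁ : ∀ A → d G (∁ A) ≡ d G A
  d-∁ A = cong ∣_∣ (∂-∁ A)

  Proper-∁ : ∀ {A} → Proper G A → Proper G (∁ A)
  Proper-∁ ((x , x∈A) , A≢⊤) with ≢⊤⇒∃∉ A≢⊤
  ... | y , y∉A = (y , x∉p⇒x∈∁p y∉A) , λ ∁A≡⊤ → x∈p⇒x∉∁p x∈A (subst (x ∈_) (sym ∁A≡⊤) ∈⊤)

  d-posimodular : ∀ A B → d G (A ─ B) + d G (B ─ A) ≤ d G A + d G B
  d-posimodular A B = begin
    d G (A ─ B) + d G (B ─ A)
      ≡⟨ cong₂ _+_ (d≡∑ (A ─ B)) (d≡∑ (B ─ A)) ⟩
    sum (cut-indicator (A ─ B)) + sum (cut-indicator (B ─ A))
      ≡⟨ sym (∑-distrib-+ (cut-indicator (A ─ B)) _) ⟩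
    ∑[ e < m G ] (cut-indicator (A ─ B) e + cut-indicator (B ─ A) e)
      ≤⟨ ∑-mono-≤ edgewise ⟩
    ∑[ e < m G ] (cut-indicator A e + cut-indicator B e)
      ≡⟨ ∑-distrib-+ (cut-indicator A) _ ⟩
    sum (cut-indicator A) + sum (cut-indicator B)
      ≡⟨ sym (cong₂ _+_ (d≡∑ A) (d≡∑ B)) ⟩
    d G A + d G B ∎
    where
    open ≤-Reasoning
    edgewise : ∀ e → cut-indicator (A ─ B) e + cut-indicator (B ─ A) e ≤ cut-indicator A e + cut-indicator B e
    edgewise e = subst₂ (λ x y → ⟦ x ⟧ + ⟦ y ⟧ ≤ cut-indicator A e + cut-indicator B e)
      (sym (separates-─ A B (ends G e))) (sym (separates-─ B A (ends G e)))
      (crossing-posimodular (lookup A u) (lookup A w) (lookup B u) (lookup B w))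
      where
      u = proj₁ (ends G e)
      w = proj₂ (ends G e)

  KEdgeConnected-mono : ∀ {j k} → j ≤ k → KEdgeConnected G k → KEdgeConnected G j
  KEdgeConnected-mono j≤k kc A proper = ≤-trans j≤k (kc A proper)

  ∂-injective-up-to-∁ : KEdgeConnected G 1 → ∀ {A B} → ∂ G A ≡ ∂ G B → A ≡ B ⊎ A ≡ ∁ B
  ∂-injective-up-to-∁ connected {A} {B} ∂A≡∂B with ¬nonempty∧≢⊤⇒⊥⊎⊤ A⊕B-improper
    where
    d[A⊕B]≡0 : d G (A ⊕ B) ≡ 0
    d[A⊕B]≡0 = trans (cong ∣_∣ (trans (∂-⊕ A B) (trans (cong (_⊕ ∂ G B) ∂A≡∂B) (p⊕p≡⊥ (∂ G B)))))
                     (∣⊥∣≡0 (m G))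
    A⊕B-improper : ¬ Proper G (A ⊕ B)
    A⊕B-improper proper = contradiction (subst (1 ≤_) d[A⊕B]≡0 (connected (A ⊕ B) proper)) λ ()
  ... | inj₁ A⊕B≡⊥ = inj₁ (trans (sym (p⊕q⊕q≡p A B)) (trans (cong (_⊕ B) A⊕B≡⊥) (⊥⊕p≡p B)))
  ... | inj₂ A⊕B≡⊤ = inj₂ (trans (sym (p⊕q⊕q≡p A B)) (trans (cong (_⊕ B) A⊕B≡⊤) (⊤⊕p≡∁p B)))

-- Critical sets

module _ (G : Graph) (k : ℕ) where

  critical-⊂ : ∀ {A B} → IsKCritical G k A → B ⊂ A → Nonempty B → k < d G B
  critical-⊂ (_ , _ , minimal) B⊂A neB = minimal _ neB (p⊂q⇒p⊆q B⊂A) (λ B≡A → ⊂-irref B≡A B⊂A)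

  ∃critical⊆ : ∀ {A} → Proper G A → d G A ≤ k → ∃ λ C → IsKCritical G k C × C ⊆ A
  ∃critical⊆ {A} = go A (⊂-wellFounded A)
    where
    go : ∀ A → Acc _⊂_ A → Proper G A → d G A ≤ k → ∃ λ C → IsKCritical G k C × C ⊆ A
    go A (acc smaller) pA dA≤k
      with anySubset? (λ B → B ⊂? A ×-dec nonempty? B ×-dec d G B ≤? k)
    ... | yes (B , B⊂A , neB , dB≤k) with go B (smaller B⊂A) (neB , B≢⊤) dB≤k
      where
      B≢⊤ : B ≢ ⊤
      B≢⊤ B≡⊤ = proj₂ pA (⊆-antisym ⊆⊤ (subst (_⊆ A) B≡⊤ (p⊂q⇒p⊆q B⊂A)))
    ...   | C , critC , C⊆B = C , critC , ⊆-trans C⊆B (p⊂q⇒p⊆q B⊂A)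
    go A _ pA dA≤k | no ∄B = A , (pA , dA≤k , minimal) , ⊆-refl
      where
      minimal : ∀ B → Nonempty B → B ⊆ A → B ≢ A → k < d G B
      minimal B neB B⊆A B≢A = ≰⇒> λ dB≤k → ∄B (B , ⊆∧≢⇒⊂ B⊆A B≢A , neB , dB≤k)

  critical-─-nonempty : ∀ {A B} → IsKCritical G k A → IsKCritical G k B → A ≢ B → Nonempty (A ─ B)
  critical-─-nonempty {A} {B} ((neA , _) , dA≤k , _) critB A≢B with nonempty? (A ─ B)
  ... | yes ne = ne
  ... | no empty = contradiction dA≤k (<⇒≱ (critical-⊂ critB (⊆∧≢⇒⊂ A⊆B A≢B) neA))
    where
    A⊆B : A ⊆ B
    A⊆B {x} x∈A = decidable-stable (x ∈? B) (λ x∉B → empty (x , x∈p∧x∉q⇒x∈p─q x∈A x∉B))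

  critical-disjoint : ∀ {A B} → IsKCritical G k A → IsKCritical G k B → A ≢ B → A ∩ B ≡ ⊥
  critical-disjoint {A} {B} critA critB A≢B with nonempty? (A ∩ B)
  ... | no empty = Empty-unique empty
  ... | yes (x , x∈A∩B) = contradiction (begin-strict
      k + k                     <⟨ +-mono-< k<d[A─B] k<d[B─A] ⟩
      d G (A ─ B) + d G (B ─ A) ≤⟨ d-posimodular G A B ⟩
      d G A + d G B             ≤⟨ +-mono-≤ (proj₁ (proj₂ critA)) (proj₁ (proj₂ critB)) ⟩
      k + k                     ∎) (<-irrefl refl)
    where
    open ≤-Reasoning
    x∈B∩A : x ∈ B ∩ A
    x∈B∩A = subst (x ∈_) (∩-comm A B) x∈A∩B
    k<d[A─B] : k < d G (A ─ B)
    k<d[A─B] = critical-⊂ critA (p∩q≢∅⇒p─q⊂p A B (x , x∈A∩B)) (critical-─-nonempty critA critB A≢B)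
    k<d[B─A] : k < d G (B ─ A)
    k<d[B─A] = critical-⊂ critB (p∩q≢∅⇒p─q⊂p B A (x , x∈B∩A)) (critical-─-nonempty critB critA (A≢B ∘ sym))

  critical⇒kcut : KEdgeConnected G k → ∀ {A} → IsKCritical G k A → IsKCut G k (∂ G A)
  critical⇒kcut kc {A} (pA , dA≤k , _) = (A , pA , refl) , ≤-antisym dA≤k (kc A pA)

  kcut-side : ∀ {S} → IsKCut G k S → ∃ λ X → Proper G X × d G X ≤ k × ∂ G X ≡ S
  kcut-side ((X , pX , ∂X≡S) , ∣S∣≡k) = X , pX , ≤-reflexive (trans (cong ∣_∣ ∂X≡S) ∣S∣≡k) , ∂X≡S

  complementary-critical-sides : ∀ {A C} → IsKCritical G k A → IsKCritical G k (∁ A) → IsKCritical G k C →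
                                 C ≡ A ⊎ C ≡ ∁ A
  complementary-critical-sides {A} {C} critA crit∁A critC with ≡-dec _≟ᵇ_ C A | ≡-dec _≟ᵇ_ C (∁ A)
  ... | yes C≡A | _ = inj₁ C≡A
  ... | no _ | yes C≡∁A = inj₂ C≡∁A
  ... | no C≢A | no C≢∁A with proj₁ (proj₁ critC)
  ...   | x , x∈C with x ∈? A
  ...     | yes x∈A = contradiction (x∈p∩q⁺ (x∈C , x∈A)) (subst (x ∉_) (sym (critical-disjoint critC critA C≢A)) ∉⊥)
  ...     | no x∉A = contradiction (x∈p∩q⁺ (x∈C , x∉p⇒x∈∁p x∉A))
                                   (subst (x ∉_) (sym (critical-disjoint critC crit∁A C≢∁A)) ∉⊥)

  complementary-critical⇒sole-kcut : ∀ {A} → IsKCritical G k A → IsKCritical G k (∁ A) →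
                                     ∀ {S} → IsKCut G k S → S ≡ ∂ G A
  complementary-critical⇒sole-kcut {A} critA crit∁A S-kcut with kcut-side S-kcut
  ... | X , pX , dX≤k , ∂X≡S = trans (sym ∂X≡S)
        (both-sides (∃critical⊆ pX dX≤k) (∃critical⊆ (Proper-∁ G pX) (subst (_≤ k) (sym (d-∁ G X)) dX≤k)))
    where
    sides : ∀ {C} → IsKCritical G k C → C ≡ A ⊎ C ≡ ∁ A
    sides = complementary-critical-sides critA crit∁A
    both-sides : (∃ λ C → IsKCritical G k C × C ⊆ X) → (∃ λ C → IsKCritical G k C × C ⊆ ∁ X) → ∂ G X ≡ ∂ G A
    both-sides (C₁ , crit₁ , C₁⊆X) (C₂ , crit₂ , C₂⊆∁X) =
      trans (cong (∂ G) X≡C₁) ([ cong (∂ G) , (λ C₁≡∁A → trans (cong (∂ G) C₁≡∁A) (∂-∁ G A)) ]′ (sides crit₁))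
      where
      C₁≢C₂ : C₁ ≢ C₂
      C₁≢C₂ C₁≡C₂ with proj₁ (proj₁ crit₁)
      ... | x , x∈C₁ = x∈p⇒x∉∁p (C₁⊆X x∈C₁) (C₂⊆∁X (subst (x ∈_) C₁≡C₂ x∈C₁))
      X≡C₁ : X ≡ C₁
      X≡C₁ = ⊆-antisym (∁p⊆∁q⇒p⊇q (subst (_⊆ ∁ X) (other-of-complementary-pair (sides crit₁) (sides crit₂) C₁≢C₂) C₂⊆∁X)) C₁⊆X

  distinct-kcuts≤#kcuts : ∀ {q t} → HasExactlyKCuts G k q → (S : Fin t → Subset (m G)) →
                          (∀ i → IsKCut G k (S i)) → (∀ i j → i ≢ j → S i ≢ S j) → t ≤ q
  distinct-kcuts≤#kcuts {q} {t} (c , _ , _ , c-all) S S-kcut distinct = injective⇒≤ index-injective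
    where
    index : Fin t → Fin q
    index i = proj₁ (c-all (S i) (S-kcut i))
    index-injective : ∀ {i j} → index i ≡ index j → i ≡ j
    index-injective {i} {j} eq = decidable-stable (i ≟ᶠ j) λ i≢j → distinct i j i≢j (begin
      S i           ≡⟨ sym (proj₂ (c-all (S i) (S-kcut i))) ⟩
      c (index i)   ≡⟨ cong c eq ⟩
      c (index j)   ≡⟨ proj₂ (c-all (S j) (S-kcut j)) ⟩
      S j           ∎)
      where open ≡-Reasoning

  sole-kcut-side-critical : 1 ≤ k → KEdgeConnected G k → ∀ {X} → Proper G X → d G X ≤ k →
                            (∀ {S} → IsKCut G k S → S ≡ ∂ G X) → IsKCritical G k X
  sole-kcut-side-critical 1≤k kc {X} pX dX≤k sole with ∃critical⊆ pX dX≤k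
  ... | C , critC , C⊆X with ∂-injective-up-to-∁ G (KEdgeConnected-mono G 1≤k kc) (sole (critical⇒kcut kc critC))
  ...   | inj₁ C≡X = subst (IsKCritical G k) C≡X critC
  ...   | inj₂ C≡∁X with proj₁ (Proper-∁ G pX)
  ...     | x , x∈∁X = contradiction x∈∁X (x∈p⇒x∉∁p (C⊆X (subst (x ∈_) (sym C≡∁X) x∈∁X)))

module _ {k : ℕ} (1≤k : 1 ≤ k) (G : Graph) (kc : KEdgeConnected G k) {t} (a : Fin t → Subset (n G))
         (critical : AllKCritical G k t a) where

  private
    a-inj : ∀ i j → a i ≡ a j → i ≡ j
    a-inj = proj₁ critical
    a-crit : ∀ i → IsKCritical G k (a i)
    a-crit = proj₁ (proj₂ critical)
    a-all : ∀ A → IsKCritical G k A → ∃ λ i → a i ≡ A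
    a-all = proj₂ (proj₂ critical)

  sole-kcut⇒complementary-critical-pair : HasExactlyKCuts G k 1 → t ≡ 2 × (∀ i j → i ≢ j → a j ≡ ∁ (a i))
  sole-kcut⇒complementary-critical-pair (c , _ , c-kcut , c-all) with kcut-side G k (c-kcut zero)
  ... | C , pC , dC≤k , ∂C≡c₀ =
        injective-enumeration-of-pair a-inj sides (a-all C critC) (a-all (∁ C) crit∁C) (p≢∁p (proj₁ pC))
      , λ i j i≢j → other-of-complementary-pair (sides i) (sides j) (i≢j ∘ a-inj i j)
    where
    sole : ∀ {S} → IsKCut G k S → S ≡ ∂ G C
    sole S-kcut with c-all _ S-kcut
    ... | zero , c₀≡S = trans (sym c₀≡S) (sym ∂C≡c₀)
    critC : IsKCritical G k C
    critC = sole-kcut-side-critical G k 1≤k kc pC dC≤k sole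
    crit∁C : IsKCritical G k (∁ C)
    crit∁C = sole-kcut-side-critical G k 1≤k kc (Proper-∁ G pC) (subst (_≤ k) (sym (d-∁ G C)) dC≤k)
               (λ S-kcut → trans (sole S-kcut) (sym (∂-∁ G C)))
    sides : ∀ i → a i ≡ C ⊎ a i ≡ ∁ C
    sides i = complementary-critical-sides G k critC crit∁C (a-crit i)

  critical-cuts-distinct : ∀ {q} → HasExactlyKCuts G k q → 2 ≤ q → ∀ i j → i ≢ j → ∂ G (a i) ≢ ∂ G (a j)
  critical-cuts-distinct (c , c-inj , c-kcut , _) (s≤s (s≤s _)) i j i≢j ∂ai≡∂aj
    with ∂-injective-up-to-∁ G (KEdgeConnected-mono G 1≤k kc) ∂ai≡∂aj
  ... | inj₁ ai≡aj = i≢j (a-inj i j ai≡aj)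
  ... | inj₂ ai≡∁aj =
        contradiction (c-inj zero (suc zero) (trans (sole (c-kcut zero)) (sym (sole (c-kcut (suc zero)))))) λ ()
    where
    sole : ∀ {S} → IsKCut G k S → S ≡ ∂ G (a j)
    sole = complementary-critical⇒sole-kcut G k (a-crit j) (subst (IsKCritical G k) ai≡∁aj (a-crit i))

-- Adding a vertex

module _ (G : Graph) (t : ℕ) (v : Fin t → V G) where

  private
    G′ : Graph
    G′ = extend G t v

  ends-extend-old : ∀ e → ends G′ (e ↑ˡ t) ≡ (inject₁ (proj₁ (ends G e)) , inject₁ (proj₂ (ends G e)))
  ends-extend-old e rewrite splitAt-↑ˡ (m G) e t = refl

  ends-extend-new : ∀ i → ends G′ (m G ↑ʳ i) ≡ (newVertex G t v , inject₁ (v i))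
  ends-extend-new i rewrite splitAt-↑ʳ (m G) t i = refl

  attachments-in : Subset (n G) → ℕ
  attachments-in X = ∑[ i < t ] ⟦ lookup X (v i) ⟧

  d-extend : ∀ {A} → newVertex G t v ∉ A → d G′ A ≡ d G (restrict A) + attachments-in (restrict A)
  d-extend {A} x∉A = begin
    d G′ A
      ≡⟨ d≡∑ G′ A ⟩
    sum (cut-indicator G′ A)
      ≡⟨ ∑-↑ (m G) (cut-indicator G′ A) ⟩
    sum (cut-indicator G′ A ∘ (_↑ˡ t)) + sum (cut-indicator G′ A ∘ (m G ↑ʳ_))
      ≡⟨ cong₂ _+_ (sum-cong-≗ old-edge) (sum-cong-≗ new-edge) ⟩
    sum (cut-indicator G (restrict A)) + attachments-in (restrict A)
      ≡⟨ cong (_+ attachments-in (restrict A)) (sym (d≡∑ G (restrict A))) ⟩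
    d G (restrict A) + attachments-in (restrict A) ∎
    where
    open ≡-Reasoning
    old-edge : ∀ e → cut-indicator G′ A (e ↑ˡ t) ≡ cut-indicator G (restrict A) e
    old-edge e = cong ⟦_⟧ (trans (cong (separates A) (ends-extend-old e))
      (sym (cong₂ _xor_ (lookup-restrict {A = A} (proj₁ (ends G e))) (lookup-restrict {A = A} (proj₂ (ends G e))))))
    new-edge : ∀ i → cut-indicator G′ A (m G ↑ʳ i) ≡ ⟦ lookup (restrict A) (v i) ⟧
    new-edge i = cong ⟦_⟧ (trans (cong (separates A) (ends-extend-new i))
      (trans (cong (_xor lookup A (inject₁ (v i))) (∉⇒lookup≡false x∉A)) (sym (lookup-restrict {A = A} (v i)))))

module _ {k : ℕ} (G : Graph) (kc : KEdgeConnected G k) {t} (a : Fin t → Subset (n G))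
         (a-all : ∀ A → IsKCritical G k A → ∃ λ i → a i ≡ A) (v : Fin t → V G) (v∈a : ∀ i → v i ∈ a i) where

  private
    G′ : Graph
    G′ = extend G t v
    x : V G′
    x = newVertex G t v

  k<d+attachments : ∀ {X} → Proper G X → k < d G X + attachments-in G t v X
  k<d+attachments {X} pX with d G X ≤? k
  ... | no dX≰k = ≤-trans (≰⇒> dX≰k) (m≤m+n _ _)
  ... | yes dX≤k with ∃critical⊆ G k pX dX≤k
  ...   | C , critC , C⊆X with a-all C critC
  ...     | i , ai≡C = subst (_≤ d G X + attachments-in G t v X) (+-comm k 1)
                         (+-mono-≤ (kc X pX) (1≤∑⟦⟧ (lookup X ∘ v) vi∈X))
    where
    vi∈X : lookup X (v i) ≡ true
    vi∈X = []=⇒lookup (C⊆X (subst (v i ∈_) ai≡C (v∈a i)))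

  extension-cut-large-∉ : ∀ A → x ∉ A → Proper G′ A → ∂ G′ A ≢ ∂ G′ ⁅ x ⁆ → k < d G′ A
  extension-cut-large-∉ A x∉A (neA , _) ∂A≢∂x with nonempty? (restrict A) | ≡-dec _≟ᵇ_ (restrict A) ⊤
  ... | no empty | _ = contradiction neA (restrict-Empty x∉A empty)
  ... | yes _ | yes A↾≡⊤ = contradiction (trans (cong (∂ G′) (restrict≡⊤ x∉A A↾≡⊤)) (∂-∁ G′ ⁅ x ⁆)) ∂A≢∂x
  ... | yes neA↾ | no A↾≢⊤ = subst (k <_) (sym (d-extend G t v x∉A)) (k<d+attachments (neA↾ , A↾≢⊤))

  extension-cut-large : ∀ A → Proper G′ A → ∂ G′ A ≢ ∂ G′ ⁅ x ⁆ → suc k ≤ d G′ A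
  extension-cut-large A pA ∂A≢∂x with x ∈? A
  ... | no x∉A = extension-cut-large-∉ A x∉A pA ∂A≢∂x
  ... | yes x∈A = subst (suc k ≤_) (d-∁ G′ A)
        (extension-cut-large-∉ (∁ A) (x∈p⇒x∉∁p x∈A) (Proper-∁ G′ pA) (∂A≢∂x ∘ trans (sym (∂-∁ G′ A))))

mainTheorem4 : (k : ℕ) → 1 ≤ k → (G : Graph) → KEdgeConnected G k →
    (q : ℕ) → HasExactlyKCuts G k q →
    (t : ℕ) (a : Fin t → Subset (n G)) → AllKCritical G k t a →
    ((∀ i j → i ≢ j → a i ∩ a j ≡ ⊥)
    × (q ≡ 1 → t ≡ 2 × (∀ i j → i ≢ j → a j ≡ ∁ (a i)))
    × (2 ≤ q → (∀ i j → i ≢ j → ∂ G (a i) ≢ ∂ G (a j)) × t ≤ q)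
    × ((v : Fin t → V G) → (∀ i → v i ∈ a i) →
        ∀ A → Proper (extend G t v) A →
          ∂ (extend G t v) A ≢ ∂ (extend G t v) ⁅ newVertex G t v ⁆ →
          suc k ≤ d (extend G t v) A))
mainTheorem4 k 1≤k G kc q cuts t a critical@(a-inj , a-crit , a-all) =
    (λ i j i≢j → critical-disjoint G k (a-crit i) (a-crit j) (i≢j ∘ a-inj i j))
  , (λ { refl → sole-kcut⇒complementary-critical-pair 1≤k G kc a critical cuts })
  , (λ 2≤q → let distinct = critical-cuts-distinct 1≤k G kc a critical cuts 2≤q
             in distinct , distinct-kcuts≤#kcuts G k cuts (∂ G ∘ a) (critical⇒kcut G k kc ∘ a-crit) distinct)
  , extension-cut-large G kc a a-all
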